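{- For any graphs $G$ and $H$, both with an identified vertex $v$, the tree cover number of their vertex sum over $v$ satisfies $T(G+_v H)=T(G)+T(H)-1$, where $G+_v H$ denotes the vertex sum of $G$ and $H$ over $v$.
   Context: The vertex sum of $G$ and $H$ over a common vertex $v$, denoted $G+_v H$, is the graph formed by identifying $v$ in the two graphs. A tree covering of a graph is a family of induced vertex-disjoint trees covering all vertices; $T(G)$ is the minimum number of trees in a tree covering of $G$. -}

module Defs where

open import Data.Nat using (ℕ; suc; _+_; _≤_; _∸_)
open import Data.Fin using (Fin; splitAt; punchIn; _≟_)
open import Data.Sum using (_⊎_; inj₁; inj₂)
open import Data.Product using (Σ; ∃; ∃-syntax; _×_; _,_)
open import Data.Maybe using (Maybe; just; nothing)
open import Data.List using (List; []; _∷_; _∷ʳ_; length)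
open import Data.List.Relation.Unary.All using (All)
open import Data.List.Relation.Unary.Unique.Propositional using (Unique)
open import Data.List.Relation.Unary.Linked using (Linked)
open import Relation.Binary.PropositionalEquality using (_≡_; refl)
open import Relation.Nullary using (¬_; yes; no)
open import Level using (0ℓ)
open import Function using (Surjective)

record Graph (n : ℕ) : Set₁ where
  field
    Adj    : Fin n → Fin n → Set
    sym    : ∀ {x y} → Adj x y → Adj y x
    irrefl : ∀ {x} → ¬ Adj x x
open Graph public

module _ {n : ℕ} (G : Graph n) (S : Fin n → Set) where

  data Walk : Fin n → Fin n → Set where
    here : ∀ {x} → S x → Walk x x
    step : ∀ {x y z} → S x → Adj G x y → Walk y z → Walk x z

  InducedConnected : Set
  InducedConnected = ∀ x y → S x → S y → Walk x y

  -- a cycle in G[S]: distinct vertices x, m₁ … mⱼ, y (j ≥ 1, so length ≥ 3),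
  -- consecutive ones adjacent, and y adjacent to x
  record InducedCycle : Set where
    field
      x y    : Fin n
      ms     : List (Fin n)
      long   : 1 ≤ length ms
      inS    : All S (x ∷ ms ∷ʳ y)
      path   : Linked (Adj G) (x ∷ ms ∷ʳ y)
      close  : Adj G y x
      unique : Unique (x ∷ ms ∷ʳ y)

  InducedAcyclic : Set
  InducedAcyclic = ¬ InducedCycle

  InducedTree : Set
  InducedTree = (∃[ x ] S x) × InducedConnected × InducedAcyclic

-- A tree covering of G with k trees: a labelling of the vertices by k classes,
-- every class nonempty (surjectivity), each class inducing a tree.  The classes
-- are then vertex-disjoint induced trees covering all vertices.
record TreeCovering {n : ℕ} (G : Graph n) (k : ℕ) : Set where
  field
    cls    : Fin n → Fin k
    onto   : Surjective _≡_ _≡_ cls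
    isTree : ∀ (i : Fin k) → InducedTree G (λ x → cls x ≡ i)

IsTreeCoverNumber : {n : ℕ} → Graph n → ℕ → Set
IsTreeCoverNumber G t = TreeCovering G t × (∀ k → TreeCovering G k → t ≤ k)

-- G has vertices Fin (suc m) with distinguished v,
-- H has vertices Fin (suc k) with distinguished w (the copy of v in H).
-- The sum has vertices Fin (suc m + k): the first suc m are G's vertices,
-- the remaining k are H's vertices other than w (via punchIn w); w is identified with v.
module _ {m k : ℕ} (G : Graph (suc m)) (v : Fin (suc m))
         (H : Graph (suc k)) (w : Fin (suc k)) where

  gPre : Fin (suc m + k) → Maybe (Fin (suc m))
  gPre z with splitAt (suc m) z
  ... | inj₁ a = just a
  ... | inj₂ _ = nothing

  hPre : Fin (suc m + k) → Maybe (Fin (suc k))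
  hPre z with splitAt (suc m) z
  ... | inj₁ a with a ≟ v
  ...   | yes _ = just w
  ...   | no  _ = nothing
  hPre z | inj₂ b = just (punchIn w b)

  SumAdj : Fin (suc m + k) → Fin (suc m + k) → Set
  SumAdj z₁ z₂ =
      (∃[ a ] ∃[ b ] (gPre z₁ ≡ just a × gPre z₂ ≡ just b × Adj G a b))
    ⊎ (∃[ a ] ∃[ b ] (hPre z₁ ≡ just a × hPre z₂ ≡ just b × Adj H a b))

  private
    sumSym : ∀ {x y} → SumAdj x y → SumAdj y x
    sumSym (inj₁ (a , b , p , q , e)) = inj₁ (b , a , q , p , sym G e)
    sumSym (inj₂ (a , b , p , q , e)) = inj₂ (b , a , q , p , sym H e)

    noLoop : ∀ {n} (K : Graph n) (o : Maybe (Fin n)) {a b} →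
             o ≡ just a → o ≡ just b → ¬ Adj K a b
    noLoop K .(just _) refl refl e = irrefl K e

    sumIrr : ∀ {x} → ¬ SumAdj x x
    sumIrr {x} (inj₁ (a , b , p , q , e)) = noLoop G (gPre x) p q e
    sumIrr {x} (inj₂ (a , b , p , q , e)) = noLoop H (hPre x) p q e

  vertexSum : Graph (suc m + k)
  vertexSum = record { Adj = SumAdj ; sym = λ {x} {y} → sumSym {x} {y} ; irrefl = λ {x} → sumIrr {x} }

module Submission where

-- The argument only uses that S = G +_v H is glued from G and H at a cut
-- vertex V: S contains induced copies of G and H ("sides") which cover S, meet
-- only in V and are joined only through V (a CutDecomposition).  For any such S:
--  * Upper bound.  Keep the trees of tree coverings of G and H, except that the
--    tree of G through V and the tree of H through V are merged.  Two trees
--    glued at a cut vertex form a tree (glueTrees), mainly because every cycle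
--    of S stays on one side of V (cycleOnOneSide).  This uses T(G) + T(H) − 1 trees.
--  * Lower bound.  A tree covering of S with K trees restricts to each side,
--    since a tree of S meeting a side restricts to a tree of it (pullbackTree).
--    Dropping unused labels (compress) gives tree coverings of G and H whose
--    labels inject into the K labels of S and overlap only in the label of V,
--    whence T(G) + T(H) ≤ K + 1 (sharedLabelCount).

open import Defs renaming (sym to Adj-sym)
open import Data.Nat using (ℕ; zero; suc; _+_; _∸_; _≤_)
open import Data.Nat.Properties using (+-suc; +-mono-≤; ∸-monoˡ-≤; ≤-trans)
open import Data.Bool using (Bool; true; false)
open import Data.Fin using (Fin; zero; suc; splitAt; join; punchIn; punchOut; _↑ˡ_; _↑ʳ_)
open import Data.Fin.Properties
  using (any?; all?; ¬∀⟶∃¬; punchIn-punchOut; punchIn-injective; suc-injective;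
         join-splitAt; injective⇒≤; punchInᵢ≢i; ↑ˡ-injective; ↑ʳ-injective;
         splitAt-↑ˡ; splitAt-↑ʳ; splitAt⁻¹-↑ˡ; splitAt⁻¹-↑ʳ)
  renaming (_≟_ to _≟ᶠ_)
open import Data.Maybe using (Maybe; just; nothing; fromMaybe)
open import Data.Maybe.Properties using (just-injective)
open import Data.Sum using (_⊎_; inj₁; inj₂)
open import Data.Product using (∃; _×_; _,_; proj₁; proj₂)
open import Data.List using (List; []; _∷_; _∷ʳ_; _++_; [_]; map)
open import Data.List.Properties using (map-++; map-∘; map-id-local; length-map; ++-assoc; ∷-injective)
open import Data.List.Membership.Propositional.Properties using (∈-∃++)
import Data.List.Membership.DecPropositional as DecMembership
open import Data.List.Relation.Unary.All as All using (All; []; _∷_)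
import Data.List.Relation.Unary.All.Properties as All
open import Data.List.Relation.Unary.Linked as Linked using (Linked; []; [-]; _∷_)
import Data.List.Relation.Unary.Linked.Properties as Linked
open import Data.List.Relation.Unary.Unique.Propositional using (Unique)
open import Data.List.Relation.Unary.AllPairs using (_∷_)
import Data.List.Relation.Unary.Unique.Propositional.Properties as Unique
open import Relation.Binary.PropositionalEquality
  using (_≡_; _≢_; refl; sym; trans; cong; subst; subst₂)
open import Relation.Nullary using (¬_; Dec; yes; no; does)
open import Relation.Binary.Definitions using (DecidableEquality)
open import Data.Empty using (⊥; ⊥-elim)
open import Function using (_∘_; id)

private
  variable
    n n₁ n₂ : ℕ

walkStart : ∀ {G : Graph n} {P x y} → Walk G P x y → P x
walkStart (here p)     = p
walkStart (step p _ _) = p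

walkEnd : ∀ {G : Graph n} {P x y} → Walk G P x y → P y
walkEnd (here p)     = p
walkEnd (step _ _ w) = walkEnd w

walkAppend : ∀ {G : Graph n} {P x y z} → Walk G P x y → Walk G P y z → Walk G P x z
walkAppend (here _)     w′ = w′
walkAppend (step p e w) w′ = step p e (walkAppend w w′)

walkReverse : ∀ {G : Graph n} {P x y} → Walk G P x y → Walk G P y x
walkReverse             (here p)     = here p
walkReverse {G = G} (step p e w) =
  walkAppend (walkReverse w) (step (walkStart w) (Adj-sym G e) (here p))

WeakHom : Graph n₁ → Graph n₂ → (Fin n₁ → Fin n₂) → Set
WeakHom G₁ G₂ f = ∀ {a b} → Adj G₁ a b → Adj G₂ (f a) (f b) ⊎ f a ≡ f b

walkMap : ∀ {G₁ : Graph n₁} {G₂ : Graph n₂} {P Q} (f : Fin n₁ → Fin n₂) →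
          WeakHom G₁ G₂ f → (∀ {a} → P a → Q (f a)) →
          ∀ {a b} → Walk G₁ P a b → Walk G₂ Q (f a) (f b)
walkMap f hom pq (here p) = here (pq p)
walkMap {G₂ = G₂} {Q = Q} f hom pq {b = b} (step p e w) with hom e
... | inj₁ e′ = step (pq p) e′ (walkMap f hom pq w)
... | inj₂ eq = subst (λ t → Walk G₂ Q t (f b)) (sym eq) (walkMap f hom pq w)

walkRefine : ∀ {G : Graph n} {P} (T : Fin n → Set) →
             (∀ {a b} → P a → P b → T a → Adj G a b → T b) →
             ∀ {x y} → T x → Walk G P x y → Walk G (λ z → P z × T z) x y
walkRefine T spread t (here p)     = here (p , t)
walkRefine T spread t (step p e w) =
  step (p , t) e (walkRefine T spread (spread p (walkStart w) t e) w)

vertices : ∀ {G : Graph n} {P} → InducedCycle G P → List (Fin n)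
vertices c = x ∷ ms ∷ʳ y where open InducedCycle c

map-vertices : ∀ {A B : Set} (f : A → B) x ms y → map f (x ∷ ms ∷ʳ y) ≡ f x ∷ map f ms ∷ʳ f y
map-vertices f x ms y = cong (f x ∷_) (map-++ f ms [ y ])

cycleAlong : ∀ {G₁ : Graph n₁} {G₂ : Graph n₂} {P Q} (f : Fin n₁ → Fin n₂)
             (c : InducedCycle G₁ P) → let open InducedCycle c in
             All Q (map f (vertices c)) → Linked (Adj G₂) (map f (vertices c)) →
             Adj G₂ (f y) (f x) → Unique (map f (vertices c)) → InducedCycle G₂ Q
cycleAlong {G₂ = G₂} {Q = Q} f c inQ linked closing unique′ = record
  { x = f x ; y = f y ; ms = map f ms
  ; long   = subst (1 ≤_) (sym (length-map f ms)) long
  ; inS    = subst (All Q) shape inQ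
  ; path   = subst (Linked (Adj G₂)) shape linked
  ; close  = closing
  ; unique = subst Unique shape unique′ }
  where
  open InducedCycle c
  shape : map f (vertices c) ≡ f x ∷ map f ms ∷ʳ f y
  shape = map-vertices f x ms y

cycleMap : ∀ {G₁ : Graph n₁} {G₂ : Graph n₂} {P Q} (f : Fin n₁ → Fin n₂) →
           (∀ {a b} → Adj G₁ a b → Adj G₂ (f a) (f b)) →
           (∀ {a b} → f a ≡ f b → a ≡ b) → (∀ {a} → P a → Q (f a)) →
           InducedCycle G₁ P → InducedCycle G₂ Q
cycleMap f hom inj pq c = cycleAlong f c
  (All.map⁺ (All.map pq inS)) (Linked.map⁺ (Linked.map hom path))
  (hom close) (Unique.map⁺ inj unique)
  where open InducedCycle c

cycleReflect : ∀ {G₁ : Graph n₁} {G₂ : Graph n₂} {P Q}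
               (f : Fin n₁ → Fin n₂) (r : Fin n₂ → Fin n₁) →
               (∀ {a b} → Adj G₂ (f a) (f b) → Adj G₁ a b) → (∀ {a} → Q (f a) → P a) →
               (c : InducedCycle G₂ Q) → All (λ z → f (r z) ≡ z) (vertices c) →
               InducedCycle G₁ P
cycleReflect {n₂ = n₂} {G₂ = G₂} {Q = Q} f r reflects qp c fr≡ = cycleAlong r c
  (All.map qp (All.map⁻ (subst (All Q) (sym lifted) inS)))
  (Linked.map reflects (Linked.map⁻ (subst (Linked (Adj G₂)) (sym lifted) path)))
  (reflects (subst₂ (Adj G₂) (sym (last fr≡)) (sym (All.head fr≡)) close))
  (Unique.map⁻ (subst Unique (sym lifted) unique))
  where
  open InducedCycle c
  lifted : map f (map r (vertices c)) ≡ vertices c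
  lifted = trans (sym (map-∘ (vertices c))) (map-id-local fr≡)
  last : ∀ {R : Fin n₂ → Set} → All R (vertices c) → R y
  last rs = proj₂ (All.∷ʳ⁻ (All.tail rs))

treeCong : ∀ {G : Graph n} {P P′ : Fin n → Set} →
           (∀ {a} → P a → P′ a) → (∀ {a} → P′ a → P a) →
           InducedTree G P → InducedTree G P′
treeCong P⇒P′ P′⇒P ((x , px) , conn , acyclic) =
  (x , P⇒P′ px) ,
  (λ a b pa pb → walkMap id inj₁ P⇒P′ (conn a b (P′⇒P pa) (P′⇒P pb))) ,
  (λ c → acyclic (cycleMap id id id P′⇒P c))

PartialTreeCovering : Graph n → ∀ {K} → (Fin n → Fin K) → Set
PartialTreeCovering G g = ∀ j → (∃ λ a → g a ≡ j) → InducedTree G (λ a → g a ≡ j)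

record Compression (G : Graph n) (K : ℕ) (g : Fin n → Fin K) : Set where
  field
    size      : ℕ
    covering  : TreeCovering G size
    embed     : Fin size → Fin K
    injective : ∀ {i j} → embed i ≡ embed j → i ≡ j
    commutes  : ∀ a → embed (TreeCovering.cls covering a) ≡ g a

-- Induction on K: while some label is unused, remove it by renumbering.
compress : ∀ (G : Graph n) K (g : Fin n → Fin K) → PartialTreeCovering G g → Compression G K g
compress G K g trees with all? (λ j → any? (λ a → g a ≟ᶠ j))
... | yes used = record
  { size = K ; embed = id ; injective = id ; commutes = λ _ → refl
  ; covering = record { cls = g ; onto = λ j → proj₁ (used j) , λ { refl → proj₂ (used j) }
                      ; isTree = λ j → trees j (used j) } }
compress G zero    g trees | no unused = ⊥-elim (unused λ ())
compress {n} G (suc K) g trees | no unused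
  with ¬∀⟶∃¬ _ _ (λ j → any? (λ a → g a ≟ᶠ j)) unused
... | j , j-unused = record
  { size = size ; covering = covering
  ; embed = punchIn j ∘ embed
  ; injective = injective ∘ punchIn-injective j _ _
  ; commutes = λ a → trans (cong (punchIn j) (commutes a)) (punchIn-punchOut (avoids a)) }
  where
  avoids : ∀ a → j ≢ g a
  avoids a e = j-unused (a , sym e)
  g′ : Fin n → Fin K
  g′ a = punchOut (avoids a)
  g′⇒g : ∀ {i a} → g′ a ≡ i → g a ≡ punchIn j i
  g′⇒g {a = a} e = trans (sym (punchIn-punchOut (avoids a))) (cong (punchIn j) e)
  g⇒g′ : ∀ {i a} → g a ≡ punchIn j i → g′ a ≡ i
  g⇒g′ {a = a} e = punchIn-injective j _ _ (trans (punchIn-punchOut (avoids a)) e)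
  trees′ : PartialTreeCovering G g′
  trees′ i (a , e) = treeCong g⇒g′ g′⇒g (trees (punchIn j i) (a , g′⇒g e))
  open Compression (compress G K g′ trees′)

disjointInjections : ∀ {a b K} (f : Fin a → Fin K) (g : Fin b → Fin K) →
                     (∀ {i j} → f i ≡ f j → i ≡ j) → (∀ {i j} → g i ≡ g j → i ≡ j) →
                     (∀ i j → f i ≢ g j) → a + b ≤ K
disjointInjections {a} {b} {K} f g f-inj g-inj disjoint =
  injective⇒≤ {f = both ∘ splitAt a} λ {x} {y} e →
    trans (sym (join-splitAt a b x))
          (trans (cong (join a b) (both-inj {splitAt a x} {splitAt a y} e)) (join-splitAt a b y))
  where
  both : Fin a ⊎ Fin b → Fin K
  both (inj₁ i) = f i
  both (inj₂ j) = g j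
  both-inj : ∀ {u v} → both u ≡ both v → u ≡ v
  both-inj {inj₁ i} {inj₁ j} e = cong inj₁ (f-inj e)
  both-inj {inj₁ i} {inj₂ j} e = ⊥-elim (disjoint i j e)
  both-inj {inj₂ i} {inj₁ j} e = ⊥-elim (disjoint j i (sym e))
  both-inj {inj₂ i} {inj₂ j} e = cong inj₂ (g-inj e)

sharedLabelCount : ∀ {a b K} (f : Fin a → Fin K) (g : Fin b → Fin K) (c : Fin K) →
                   (∀ {i j} → f i ≡ f j → i ≡ j) → (∀ {i j} → g i ≡ g j → i ≡ j) →
                   (∀ i j → f i ≡ g j → g j ≡ c) → a + b ≤ suc K
sharedLabelCount {b = b} {K} f g c f-inj g-inj shared =
  disjointInjections (suc ∘ f) slot (f-inj ∘ suc-injective) slot-inj disjoint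
  where
  -- g, with the shared label moved to the fresh label zero
  slot : Fin b → Fin (suc K)
  slot j with g j ≟ᶠ c
  ... | yes _ = zero
  ... | no _  = suc (g j)
  slot-inj : ∀ {i j} → slot i ≡ slot j → i ≡ j
  slot-inj {i} {j} e with g i ≟ᶠ c | g j ≟ᶠ c
  ... | yes gi≡c | yes gj≡c = g-inj (trans gi≡c (sym gj≡c))
  ... | no _     | no _     = g-inj (suc-injective e)
  slot-inj () | yes _ | no _
  slot-inj () | no _  | yes _
  disjoint : ∀ i j → suc (f i) ≢ slot j
  disjoint i j e with g j ≟ᶠ c
  disjoint i j () | yes _
  ... | no gj≢c = gj≢c (shared i j (suc-injective e))

module _ {A : Set} {R : A → A → Set} where

  linkedPrefix : ∀ as {bs} → Linked R (as ++ bs) → Linked R as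
  linkedPrefix []           _       = []
  linkedPrefix (a ∷ [])     _       = [-]
  linkedPrefix (a ∷ b ∷ as) (r ∷ l) = r ∷ linkedPrefix (b ∷ as) l

  linkedSuffix : ∀ as {bs} → Linked R (as ++ bs) → Linked R bs
  linkedSuffix []       l = l
  linkedSuffix (a ∷ as) l = linkedSuffix as (Linked.tail l)

  linkedSnoc : ∀ xs {y z} → Linked R (xs ∷ʳ y) → R y z → Linked R ((xs ∷ʳ y) ∷ʳ z)
  linkedSnoc []           _        r = r ∷ [-]
  linkedSnoc (a ∷ [])     (r₁ ∷ l) r = r₁ ∷ linkedSnoc [] l r
  linkedSnoc (a ∷ b ∷ xs) (r₁ ∷ l) r = r₁ ∷ linkedSnoc (b ∷ xs) l r

-- Merging two families of labels Fin a and Fin (suc b) into Fin (a + b), where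
-- the label c of the second family is identified with the label d of the first.
module MergeLabels {a b : ℕ} (d : Fin a) (c : Fin (suc b)) where

  ↑ˡ≢↑ʳ : ∀ {i j} → i ↑ˡ b ≢ a ↑ʳ j
  ↑ˡ≢↑ʳ {i} {j} e with trans (sym (splitAt-↑ˡ a i b)) (trans (cong (splitAt a) e) (splitAt-↑ʳ a b j))
  ... | ()

  mergeLabel : Fin (suc b) → Fin (a + b)
  mergeLabel t with c ≟ᶠ t
  ... | yes _ = d ↑ˡ b
  ... | no c≢ = a ↑ʳ punchOut c≢

  mergeLabel-c : mergeLabel c ≡ d ↑ˡ b
  mergeLabel-c with c ≟ᶠ c
  ... | yes _  = refl
  ... | no c≢  = ⊥-elim (c≢ refl)

  mergeLabel-punchIn : ∀ j → mergeLabel (punchIn c j) ≡ a ↑ʳ j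
  mergeLabel-punchIn j with c ≟ᶠ punchIn c j
  ... | yes c≡ = ⊥-elim (punchInᵢ≢i c j (sym c≡))
  ... | no c≢  = cong (a ↑ʳ_) (punchIn-injective c _ _ (punchIn-punchOut c≢))

  mergeLabel-↑ˡ : ∀ {t i} → mergeLabel t ≡ i ↑ˡ b → d ≡ i
  mergeLabel-↑ˡ {t} e with c ≟ᶠ t
  ... | yes _ = ↑ˡ-injective b _ _ e
  ... | no _  = ⊥-elim (↑ˡ≢↑ʳ (sym e))

  mergeLabel-↑ʳ : ∀ {t j} → mergeLabel t ≡ a ↑ʳ j → t ≡ punchIn c j
  mergeLabel-↑ʳ {t} e with c ≟ᶠ t
  ... | yes _  = ⊥-elim (↑ˡ≢↑ʳ e)
  ... | no c≢  = trans (sym (punchIn-punchOut c≢)) (cong (punchIn c) (↑ʳ-injective a _ _ e))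

  mergeLabel-d : ∀ {t} → mergeLabel t ≡ d ↑ˡ b → t ≡ c
  mergeLabel-d {t} e with c ≟ᶠ t
  ... | yes c≡ = sym c≡
  ... | no _   = ⊥-elim (↑ˡ≢↑ʳ (sym e))

-- Colour the vertices of a graph (given by its
-- adjacency R) so that edges avoiding the vertex V never change colour, i.e.
-- the colour is constant on the parts into which V cuts the graph.
module CutVertex {A C : Set} (_≟_ : DecidableEquality A) (R : A → A → Set) (V : A)
                 (colour : A → C)
                 (edgeColour : ∀ {a b} → R a b → V ≢ a → V ≢ b → colour a ≡ colour b)
                 where

  Monochrome : C → List A → Set
  Monochrome c = All (λ z → colour z ≡ c)

  OnSide : C → A → Set
  OnSide c z = z ≡ V ⊎ colour z ≡ c

  pathColour : ∀ {z zs} → Linked R (z ∷ zs) → All (V ≢_) (z ∷ zs) → Monochrome (colour z) (z ∷ zs)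
  pathColour [-]     _           = refl ∷ []
  pathColour (r ∷ l) (nz ∷ nzs) =
    refl ∷ All.map (λ e → trans e (sym (edgeColour r nz (All.head nzs)))) (pathColour l nzs)

  pathColourʳ : ∀ zs {z} → Linked R (zs ∷ʳ z) → All (V ≢_) (zs ∷ʳ z) →
                Monochrome (colour z) (zs ∷ʳ z)
  pathColourʳ []           _       _         = refl ∷ []
  pathColourʳ (a ∷ [])     (r ∷ l) (na ∷ ns) = edgeColour r na (All.head ns) ∷ pathColourʳ [] l ns
  pathColourʳ (a ∷ b ∷ zs) (r ∷ l) (na ∷ ns) with pathColourʳ (b ∷ zs) l ns
  ... | mono = trans (edgeColour r na (All.head ns)) (All.head mono) ∷ mono

  uniqueAround : ∀ as {bs} → Unique (as ++ V ∷ bs) → All (V ≢_) as × All (V ≢_) bs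
  uniqueAround []       (V≢bs ∷ _) = [] , V≢bs
  uniqueAround (a ∷ as) (a≢ ∷ u) with uniqueAround as u
  ... | V≢as , V≢bs = (λ V≡a → All.head (All.++⁻ʳ as a≢) (sym V≡a)) ∷ V≢as , V≢bs

  afterCut : ∀ {zs} → Linked R (V ∷ zs) → All (V ≢_) zs → ∃ λ c → All (OnSide c) (V ∷ zs)
  afterCut {[]}     _ _   = colour V , inj₁ refl ∷ []
  afterCut {z ∷ zs} l V≢ = colour z , inj₁ refl ∷ All.map inj₂ (pathColour (Linked.tail l) V≢)

  throughCut : ∀ p P Q → Linked R ((p ∷ P ++ V ∷ Q) ∷ʳ p) →
               All (V ≢_) (p ∷ P) → All (V ≢_) Q → All (OnSide (colour p)) (p ∷ P ++ V ∷ Q)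
  throughCut p P Q closed V≢P V≢Q =
    All.++⁺ (All.map inj₂ (pathColour before V≢P))
            (inj₁ refl ∷ All.map inj₂ (proj₁ (All.∷ʳ⁻ (pathColourʳ Q after V≢after))))
    where
    closed′ : Linked R ((p ∷ P) ++ V ∷ (Q ∷ʳ p))
    closed′ = subst (Linked R) (++-assoc (p ∷ P) (V ∷ Q) [ p ]) closed
    before : Linked R (p ∷ P)
    before = linkedPrefix (p ∷ P) closed′
    after : Linked R (Q ∷ʳ p)
    after = Linked.tail (linkedSuffix (p ∷ P) closed′)
    V≢after : All (V ≢_) (Q ∷ʳ p)
    V≢after = All.∷ʳ⁺ V≢Q (All.head V≢P)

  open DecMembership _≟_ using (_∈?_)

  cycleOnOneSide : ∀ x ms y → Linked R (x ∷ ms ∷ʳ y) → R y x → Unique (x ∷ ms ∷ʳ y) →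
                   ∃ λ c → All (OnSide c) (x ∷ ms ∷ʳ y)
  cycleOnOneSide x ms y path close unique with V ∈? (x ∷ ms ∷ʳ y)
  ... | no V∉ = colour y , All.map inj₂ (pathColourʳ (x ∷ ms) path (All.¬Any⇒All¬ _ V∉))
  ... | yes V∈ with ∈-∃++ V∈
  ...   | [] , Q , eq =
    subst (λ L → ∃ λ c → All (OnSide c) L) (sym eq)
          (afterCut (subst (Linked R) eq path) (proj₂ (uniqueAround [] (subst Unique eq unique))))
  ...   | p ∷ P , Q , eq with ∷-injective eq
  ...     | refl , _ = colour p , subst (All (OnSide (colour p))) (sym eq)
                                      (throughCut p P Q closed (proj₁ around) (proj₂ around))
    where
    closed : Linked R ((p ∷ P ++ V ∷ Q) ∷ʳ p)
    closed = subst (λ L → Linked R (L ∷ʳ p)) eq (linkedSnoc (x ∷ ms) path close)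
    around : All (V ≢_) (p ∷ P) × All (V ≢_) Q
    around = uniqueAround (p ∷ P) (subst Unique eq unique)

-- A side of a graph S at a vertex V: an induced copy ι of G inside S that
-- contains V and is separated from the rest of S by V, together with a
-- retraction π collapsing everything outside the copy onto V.
record Side {N n : ℕ} (S : Graph N) (V : Fin N) (G : Graph n) : Set₁ where
  field
    On     : Fin N → Set
    on?    : ∀ z → Dec (On z)
    ι      : Fin n → Fin N
    π      : Fin N → Fin n
    On-ι   : ∀ x → On (ι x)
    ι-π    : ∀ {z} → On z → ι (π z) ≡ z
    π-ι    : ∀ x → π (ι x) ≡ x
    ι-adj  : ∀ {a b} → Adj G a b → Adj S (ι a) (ι b)
    ι-adj⁻ : ∀ {a b} → Adj S (ι a) (ι b) → Adj G a b
    On-V   : On V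
    π-off  : ∀ {z} → ¬ On z → π z ≡ π V
    exit   : ∀ {z z′} → Adj S z z′ → On z → ¬ On z′ → z ≡ V

module SideTrees {N n : ℕ} {S : Graph N} {V : Fin N} {G : Graph n} (side : Side S V G) where
  open Side side

  ι-π-V : ι (π V) ≡ V
  ι-π-V = ι-π On-V

  ι-injective : ∀ {a b} → ι a ≡ ι b → a ≡ b
  ι-injective {a} {b} e = trans (sym (π-ι a)) (trans (cong π e) (π-ι b))

  π-weakHom : WeakHom S G π
  π-weakHom {a} {b} e with on? a | on? b
  ... | yes oa | yes ob = inj₁ (ι-adj⁻ (subst₂ (Adj S) (sym (ι-π oa)) (sym (ι-π ob)) e))
  ... | yes oa | no ob  = inj₂ (trans (cong π (exit e oa ob)) (sym (π-off ob)))
  ... | no oa  | yes ob = inj₂ (trans (π-off oa) (cong π (sym (exit (Adj-sym S e) ob oa))))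
  ... | no oa  | no ob  = inj₂ (trans (π-off oa) (sym (π-off ob)))

  -- Inside S[P], one can leave the side only through V, so either we stay on
  -- the side or V belongs to P.
  staysOn : (P : Fin N → Set) → ∀ {a b} → P a → P b → On a ⊎ P V → Adj S a b → On b ⊎ P V
  staysOn P pa pb (inj₂ pV) e = inj₂ pV
  staysOn P {b = b} pa pb (inj₁ oa) e with on? b
  ... | yes ob = inj₁ ob
  ... | no ob  = inj₂ (subst P (exit e oa ob) pa)

  leaveThroughCut : ∀ {P a b} → InducedConnected S P → P a → P b → On a → On b ⊎ P V
  leaveThroughCut {P} {a} {b} conn pa pb oa =
    proj₂ (walkEnd (walkRefine _ (staysOn P) (inj₁ oa) (conn a b pa pb)))

  -- A tree of S meeting the side restricts to a tree of G: a walk in S[P] between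
  -- two vertices of the side leaves the side only through V, so it retracts by π
  -- to a walk in G[P ∘ ι]; cycles of G[P ∘ ι] embed by ι.
  pullbackTree : ∀ {P} → InducedTree S P → (∃ λ x → P (ι x)) → InducedTree G (P ∘ ι)
  pullbackTree {P} (_ , conn , acyclic) nonempty = nonempty , conn′ , acyclic′
    where
    back : ∀ {z} → P z × (On z ⊎ P V) → P (ι (π z))
    back (pz , inj₁ oz) = subst P (sym (ι-π oz)) pz
    back {z} (pz , inj₂ pV) with on? z
    ... | yes oz = subst P (sym (ι-π oz)) pz
    ... | no oz  = subst P (sym (trans (cong ι (π-off oz)) ι-π-V)) pV
    conn′ : InducedConnected G (P ∘ ι)
    conn′ a b pa pb = subst₂ (Walk G (P ∘ ι)) (π-ι a) (π-ι b)
      (walkMap π π-weakHom back (walkRefine _ (staysOn P) (inj₁ (On-ι a)) (conn (ι a) (ι b) pa pb)))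
    acyclic′ : InducedAcyclic G (P ∘ ι)
    acyclic′ c = acyclic (cycleMap ι ι-adj ι-injective id c)

  module _ {Q : Fin n → Set} {P : Fin N → Set}
           (Q⇒P : ∀ {x} → Q x → P (ι x)) (P⇒Q : ∀ {z} → On z → P z → Q (π z)) where

    pushWalk : InducedConnected G Q → ∀ {u z} → On u → On z → P u → P z → Walk S P u z
    pushWalk conn ou oz pu pz = subst₂ (Walk S P) (ι-π ou) (ι-π oz)
      (walkMap ι (inj₁ ∘ ι-adj) Q⇒P (conn _ _ (P⇒Q ou pu) (P⇒Q oz pz)))

    pushAcyclic : InducedAcyclic G Q → (c : InducedCycle S P) → All On (vertices c) → ⊥
    pushAcyclic acyclic c on = acyclic (cycleReflect ι π ι-adj⁻ P⇒Q′ c (All.map ι-π on))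
      where
      P⇒Q′ : ∀ {x} → P (ι x) → Q x
      P⇒Q′ {x} p = subst Q (π-ι x) (P⇒Q (On-ι x) p)

    pushTree : (∀ {z} → P z → On z) → InducedTree G Q → InducedTree S P
    pushTree P⇒On ((x , qx) , conn , acyclic) = (ι x , Q⇒P qx) , conn′ , acyclic′
      where
      conn′ : InducedConnected S P
      conn′ u z pu pz = pushWalk conn (P⇒On pu) (P⇒On pz) pu pz
      acyclic′ : InducedAcyclic S P
      acyclic′ c = pushAcyclic acyclic c (All.map P⇒On (InducedCycle.inS c))

record CutDecomposition {N n₁ n₂ : ℕ} (S : Graph N) (V : Fin N) (G : Graph n₁) (H : Graph n₂) : Set₁ where
  field
    left  : Side S V G
    right : Side S V H
    cover : ∀ {z} → ¬ Side.On left z → Side.On right z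
    meet  : ∀ {z} → Side.On left z → Side.On right z → z ≡ V

module GluingAtCutVertex {N n₁ n₂ : ℕ} {S : Graph N} {V : Fin N} {G : Graph n₁} {H : Graph n₂}
             (D : CutDecomposition S V G H) where
  open CutDecomposition D
  module L = Side left
  module R = Side right
  module LT = SideTrees left
  module RT = SideTrees right

  sideOf : ∀ z → L.On z ⊎ R.On z
  sideOf z with L.on? z
  ... | yes oz = inj₁ oz
  ... | no ¬oz = inj₂ (cover ¬oz)

  -- Colouring S by sides, to apply the cut-vertex lemma to cycles of S.
  isLeft : Fin N → Bool
  isLeft z = does (L.on? z)

  isLeft-true : ∀ {z} → isLeft z ≡ true → L.On z
  isLeft-true {z} e  with L.on? z
  ... | yes oz = oz
  isLeft-true {z} () | no _

  isLeft-false : ∀ {z} → isLeft z ≡ false → R.On z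
  isLeft-false {z} e  with L.on? z
  isLeft-false {z} () | yes _
  ... | no ¬oz = cover ¬oz

  sameSide : ∀ {a b} → Adj S a b → V ≢ a → V ≢ b → isLeft a ≡ isLeft b
  sameSide {a} {b} e V≢a V≢b with L.on? a | L.on? b
  ... | yes _  | yes _  = refl
  ... | no _   | no _   = refl
  ... | yes oa | no ob  = ⊥-elim (V≢a (sym (L.exit e oa ob)))
  ... | no oa  | yes ob = ⊥-elim (V≢b (sym (L.exit (Adj-sym S e) ob oa)))

  open CutVertex _≟ᶠ_ (Adj S) V isLeft sameSide using (OnSide; cycleOnOneSide)

  glueTrees : ∀ {QG QH P} →
              (∀ {x} → QG x → P (L.ι x)) → (∀ {z} → L.On z → P z → QG (L.π z)) →
              (∀ {y} → QH y → P (R.ι y)) → (∀ {z} → R.On z → P z → QH (R.π z)) →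
              P V → InducedTree G QG → InducedTree H QH → InducedTree S P
  glueTrees {P = P} QG⇒P P⇒QG QH⇒P P⇒QH pV (_ , connG , acyclicG) (_ , connH , acyclicH) =
    (V , pV) , conn , acyclic
    where
    toCut : ∀ {u} → P u → Walk S P u V
    toCut {u} pu with sideOf u
    ... | inj₁ ou = LT.pushWalk QG⇒P P⇒QG connG ou L.On-V pu pV
    ... | inj₂ ou = RT.pushWalk QH⇒P P⇒QH connH ou R.On-V pu pV
    conn : InducedConnected S P
    conn u z pu pz = walkAppend (toCut pu) (walkReverse (toCut pz))
    onLeft : ∀ {z} → OnSide true z → L.On z
    onLeft (inj₁ refl) = L.On-V
    onLeft (inj₂ e)    = isLeft-true e
    onRight : ∀ {z} → OnSide false z → R.On z
    onRight (inj₁ refl) = R.On-V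
    onRight (inj₂ e)    = isLeft-false e
    acyclic : InducedAcyclic S P
    acyclic c with cycleOnOneSide x ms y path close unique
      where open InducedCycle c
    ... | true  , sides = LT.pushAcyclic QG⇒P P⇒QG acyclicG c (All.map onLeft sides)
    ... | false , sides = RT.pushAcyclic QH⇒P P⇒QH acyclicH c (All.map onRight sides)

  -- Lower bound: a tree covering of S restricts to partial tree coverings of
  -- G and H whose labels are shared only through the label of V.
  lowerBound : ∀ {tG tH K} →
               (∀ k → TreeCovering G k → tG ≤ k) → (∀ k → TreeCovering H k → tH ≤ k) →
               TreeCovering S K → tG + tH ∸ 1 ≤ K
  lowerBound {K = K} minG minH coverS =
    ∸-monoˡ-≤ 1 (≤-trans (+-mono-≤ (minG _ CG.covering) (minH _ CH.covering))
                         (sharedLabelCount CG.embed CH.embed (cls V) CG.injective CH.injective shared))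
    where
    open TreeCovering coverS
    module CG = Compression (compress G K (cls ∘ L.ι) (λ j → LT.pullbackTree (isTree j)))
    module CH = Compression (compress H K (cls ∘ R.ι) (λ j → RT.pullbackTree (isTree j)))
    meetsBoth : ∀ x y → cls (L.ι x) ≡ cls (R.ι y) → cls (R.ι y) ≡ cls V
    meetsBoth x y e
      with RT.leaveThroughCut {a = R.ι y} {b = L.ι x} (proj₁ (proj₂ (isTree (cls (R.ι y))))) refl e (R.On-ι y)
    ... | inj₁ onRight = trans (sym e) (cong cls (meet (L.On-ι x) onRight))
    ... | inj₂ V∈     = sym V∈
    shared : ∀ i j → CG.embed i ≡ CH.embed j → CH.embed j ≡ cls V
    shared i j e with TreeCovering.onto CG.covering i | TreeCovering.onto CH.covering j
    ... | x , x↦i | y , y↦j = trans embed-j (meetsBoth x y (trans (sym embed-i) (trans e embed-j)))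
      where
      embed-i : CG.embed i ≡ cls (L.ι x)
      embed-i = trans (cong CG.embed (sym (x↦i refl))) (CG.commutes x)
      embed-j : CH.embed j ≡ cls (R.ι y)
      embed-j = trans (cong CH.embed (sym (y↦j refl))) (CH.commutes y)

  -- Upper bound: tree coverings of G and H with a and b + 1 trees glue to a
  -- tree covering of S with a + b trees, the two trees through V becoming one.
  module Merge {a b : ℕ} (coverG : TreeCovering G a) (coverH : TreeCovering H (suc b)) where
    open TreeCovering coverG renaming (cls to clsG; onto to ontoG; isTree to treeG)
    open TreeCovering coverH renaming (cls to clsH; onto to ontoH; isTree to treeH)

    cG : Fin a
    cG = clsG (L.π V)
    cH : Fin (suc b)
    cH = clsH (R.π V)

    -- the labels of H are renamed, the label of V in H becoming its label in G
    open MergeLabels cG cH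

    label : Fin N → Fin (a + b)
    label z with L.on? z
    ... | yes _ = clsG (L.π z) ↑ˡ b
    ... | no _  = mergeLabel (clsH (R.π z))

    label-left : ∀ {z} → L.On z → label z ≡ clsG (L.π z) ↑ˡ b
    label-left {z} oz with L.on? z
    ... | yes _  = refl
    ... | no ¬oz = ⊥-elim (¬oz oz)

    label-right : ∀ {z} → R.On z → label z ≡ mergeLabel (clsH (R.π z))
    label-right {z} oz with L.on? z
    ... | no _    = refl
    ... | yes olz with meet olz oz
    ...   | refl = sym mergeLabel-c

    label-ιL : ∀ x → label (L.ι x) ≡ clsG x ↑ˡ b
    label-ιL x = trans (label-left (L.On-ι x)) (cong (λ u → clsG u ↑ˡ b) (L.π-ι x))

    label-ιR : ∀ y → label (R.ι y) ≡ mergeLabel (clsH y)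
    label-ιR y = trans (label-right (R.On-ι y)) (cong (mergeLabel ∘ clsH) (R.π-ι y))

    LabelTree : Fin (a + b) → Set
    LabelTree t = InducedTree S (λ z → label z ≡ t)

    leftTree : ∀ i → cG ≢ i → LabelTree (i ↑ˡ b)
    leftTree i cG≢i = LT.pushTree Q⇒P P⇒Q P⇒On (treeG i)
      where
      Q⇒P : ∀ {x} → clsG x ≡ i → label (L.ι x) ≡ i ↑ˡ b
      Q⇒P {x} e = trans (label-ιL x) (cong (_↑ˡ b) e)
      P⇒Q : ∀ {z} → L.On z → label z ≡ i ↑ˡ b → clsG (L.π z) ≡ i
      P⇒Q oz e = ↑ˡ-injective b _ _ (trans (sym (label-left oz)) e)
      P⇒On : ∀ {z} → label z ≡ i ↑ˡ b → L.On z
      P⇒On {z} e with sideOf z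
      ... | inj₁ oz = oz
      ... | inj₂ oz = ⊥-elim (cG≢i (mergeLabel-↑ˡ (trans (sym (label-right oz)) e)))

    rightTree : ∀ j → LabelTree (a ↑ʳ j)
    rightTree j = RT.pushTree Q⇒P P⇒Q P⇒On (treeH (punchIn cH j))
      where
      Q⇒P : ∀ {y} → clsH y ≡ punchIn cH j → label (R.ι y) ≡ a ↑ʳ j
      Q⇒P {y} e = trans (label-ιR y) (trans (cong mergeLabel e) (mergeLabel-punchIn j))
      P⇒Q : ∀ {z} → R.On z → label z ≡ a ↑ʳ j → clsH (R.π z) ≡ punchIn cH j
      P⇒Q oz e = mergeLabel-↑ʳ (trans (sym (label-right oz)) e)
      P⇒On : ∀ {z} → label z ≡ a ↑ʳ j → R.On z
      P⇒On {z} e with sideOf z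
      ... | inj₁ oz = ⊥-elim (↑ˡ≢↑ʳ (trans (sym (label-left oz)) e))
      ... | inj₂ oz = oz

    sharedTree : LabelTree (cG ↑ˡ b)
    sharedTree = glueTrees QG⇒P P⇒QG QH⇒P P⇒QH (label-left L.On-V) (treeG cG) (treeH cH)
      where
      QG⇒P : ∀ {x} → clsG x ≡ cG → label (L.ι x) ≡ cG ↑ˡ b
      QG⇒P {x} e = trans (label-ιL x) (cong (_↑ˡ b) e)
      P⇒QG : ∀ {z} → L.On z → label z ≡ cG ↑ˡ b → clsG (L.π z) ≡ cG
      P⇒QG oz e = ↑ˡ-injective b _ _ (trans (sym (label-left oz)) e)
      QH⇒P : ∀ {y} → clsH y ≡ cH → label (R.ι y) ≡ cG ↑ˡ b
      QH⇒P {y} e = trans (label-ιR y) (trans (cong mergeLabel e) mergeLabel-c)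
      P⇒QH : ∀ {z} → R.On z → label z ≡ cG ↑ˡ b → clsH (R.π z) ≡ cH
      P⇒QH oz e = mergeLabel-d (trans (sym (label-right oz)) e)

    labelTree : ∀ t → LabelTree t
    labelTree t with splitAt a t in eq
    ... | inj₂ j = subst LabelTree (splitAt⁻¹-↑ʳ eq) (rightTree j)
    ... | inj₁ i with cG ≟ᶠ i
    ...   | yes refl = subst LabelTree (splitAt⁻¹-↑ˡ eq) sharedTree
    ...   | no cG≢i  = subst LabelTree (splitAt⁻¹-↑ˡ eq) (leftTree i cG≢i)

    labelOnto : ∀ t → ∃ λ z → ∀ {z′} → z′ ≡ z → label z′ ≡ t
    labelOnto t with splitAt a t in eq
    ... | inj₁ i with ontoG i
    ...   | x , x↦i = L.ι x , λ { refl →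
      trans (label-ιL x) (trans (cong (_↑ˡ b) (x↦i refl)) (splitAt⁻¹-↑ˡ eq)) }
    labelOnto t | inj₂ j with ontoH (punchIn cH j)
    ...   | y , y↦j = R.ι y , λ { refl →
      trans (label-ιR y)
            (trans (cong mergeLabel (y↦j refl)) (trans (mergeLabel-punchIn j) (splitAt⁻¹-↑ʳ eq))) }

    merged : TreeCovering S (a + b)
    merged = record { cls = label ; onto = labelOnto ; isTree = labelTree }

  upperBound : ∀ {a b} → TreeCovering G a → TreeCovering H b → TreeCovering S (a + b ∸ 1)
  -- (H contains a vertex, so it cannot be covered by zero trees)
  upperBound {b = zero} _ coverH with TreeCovering.cls coverH (R.π V)
  ... | ()
  upperBound {a} {suc b} coverG coverH =
    subst (TreeCovering S) (cong (_∸ 1) (sym (+-suc a b))) (Merge.merged coverG coverH)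

-- Building a side from an embedding ι of G with a partial inverse p (with
-- p V = just base), in a graph S whose edges either join two vertices in the
-- image of ι and come from G, or join two vertices of a set Other which meets
-- the image of ι only in V.
module PartialInverseSide {N n : ℕ} (S : Graph N) (V : Fin N) (G : Graph n)
  (p : Fin N → Maybe (Fin n)) (ι : Fin n → Fin N) (base : Fin n)
  (p-ι : ∀ x → p (ι x) ≡ just x) (p-just : ∀ {z x} → p z ≡ just x → z ≡ ι x)
  (p-V : p V ≡ just base)
  where

  -- the image of ι
  Defined : Fin N → Set
  Defined z = ∃ λ x → p z ≡ just x

  defined? : ∀ z → Dec (Defined z)
  defined? z with p z
  ... | just x  = yes (x , refl)
  ... | nothing = no λ ()

  EdgeOfG : Fin N → Fin N → Set
  EdgeOfG z z′ = ∃ λ a → ∃ λ b → p z ≡ just a × p z′ ≡ just b × Adj G a b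

  module _ (Other : Fin N → Set) (meet : ∀ {z} → Defined z → Other z → z ≡ V)
           (toS : ∀ {z z′} → EdgeOfG z z′ → Adj S z z′)
           (split : ∀ {z z′} → Adj S z z′ → EdgeOfG z z′ ⊎ (Other z × Other z′)) where

    π : Fin N → Fin n
    π z = fromMaybe base (p z)

    side : Side S V G
    side = record
      { On = Defined ; on? = defined? ; ι = ι ; π = π
      ; On-ι   = λ x → x , p-ι x
      ; ι-π    = λ { (x , px) → trans (cong (ι ∘ fromMaybe base) px) (sym (p-just px)) }
      ; π-ι    = λ x → cong (fromMaybe base) (p-ι x)
      ; ι-adj  = λ {a} {b} e → toS (a , b , p-ι a , p-ι b , e)
      ; ι-adj⁻ = reflect
      ; On-V   = base , p-V
      ; π-off  = off
      ; exit   = exit }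
      where
      reflect : ∀ {a b} → Adj S (ι a) (ι b) → Adj G a b
      reflect {a} {b} e with split e
      ... | inj₁ (a′ , b′ , pa , pb , e′) =
        subst₂ (Adj G) (just-injective (trans (sym pa) (p-ι a))) (just-injective (trans (sym pb) (p-ι b))) e′
      ... | inj₂ (oa , ob) =
        ⊥-elim (irrefl S (subst (Adj S (ι a)) (trans (meet (b , p-ι b) ob) (sym (meet (a , p-ι a) oa))) e))
      off : ∀ {z} → ¬ Defined z → π z ≡ π V
      off {z} ¬dz with p z
      ... | just x  = ⊥-elim (¬dz (x , refl))
      ... | nothing = sym (cong (fromMaybe base) p-V)
      exit : ∀ {z z′} → Adj S z z′ → Defined z → ¬ Defined z′ → z ≡ V
      exit e dz ¬dz′ with split e
      ... | inj₁ (_ , b , _ , pz′ , _) = ⊥-elim (¬dz′ (b , pz′))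
      ... | inj₂ (oz , _)             = meet dz oz

module VertexSumDecomposition {m k : ℕ} (G : Graph (suc m)) (v : Fin (suc m))
                              (H : Graph (suc k)) (w : Fin (suc k)) where
  S : Graph (suc m + k)
  S = vertexSum G v H w

  gP : Fin (suc m + k) → Maybe (Fin (suc m))
  gP = gPre G v H w

  hP : Fin (suc m + k) → Maybe (Fin (suc k))
  hP = hPre G v H w

  V : Fin (suc m + k)
  V = v ↑ˡ k

  inG : Fin (suc m) → Fin (suc m + k)
  inG a = a ↑ˡ k

  inH : Fin (suc k) → Fin (suc m + k)
  inH y with w ≟ᶠ y
  ... | yes _  = V
  ... | no w≢y = suc m ↑ʳ punchOut w≢y

  InG InH : Fin (suc m + k) → Set
  InG z = ∃ λ a → gP z ≡ just a
  InH z = ∃ λ y → hP z ≡ just y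

  gP-inG : ∀ a → gP (inG a) ≡ just a
  gP-inG a rewrite splitAt-↑ˡ (suc m) a k = refl

  gP-just : ∀ {z a} → gP z ≡ just a → z ≡ inG a
  gP-just {z} e with splitAt (suc m) z in eq
  gP-just {z} refl | inj₁ a = sym (splitAt⁻¹-↑ˡ eq)
  gP-just {z} ()   | inj₂ _

  hP-V : hP V ≡ just w
  hP-V rewrite splitAt-↑ˡ (suc m) v k with v ≟ᶠ v
  ... | yes _  = refl
  ... | no v≢v = ⊥-elim (v≢v refl)

  hP-inH : ∀ y → hP (inH y) ≡ just y
  hP-inH y with w ≟ᶠ y
  ... | yes refl = hP-V
  ... | no w≢y rewrite splitAt-↑ʳ (suc m) k (punchOut w≢y) = cong just (punchIn-punchOut w≢y)

  hP-just : ∀ {z y} → hP z ≡ just y → z ≡ inH y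
  hP-just {z} e with splitAt (suc m) z in eq
  ... | inj₁ a with a ≟ᶠ v
  hP-just {z} refl | inj₁ a | yes a≡v with w ≟ᶠ w
  ...   | yes _  = trans (sym (splitAt⁻¹-↑ˡ eq)) (cong inG a≡v)
  ...   | no w≢w = ⊥-elim (w≢w refl)
  hP-just {z} () | inj₁ a | no _
  hP-just {z} refl | inj₂ b with w ≟ᶠ punchIn w b
  ... | yes w≡ = ⊥-elim (punchInᵢ≢i w b (sym w≡))
  ... | no w≢  = trans (sym (splitAt⁻¹-↑ʳ eq))
                       (cong (suc m ↑ʳ_) (punchIn-injective w _ _ (sym (punchIn-punchOut w≢))))

  cover : ∀ {z} → ¬ InG z → InH z
  cover {z} ¬inG with splitAt (suc m) z
  ... | inj₁ a = ⊥-elim (¬inG (a , refl))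
  ... | inj₂ b = punchIn w b , refl

  meet : ∀ {z} → InG z → InH z → z ≡ V
  meet {z} gz hz with splitAt (suc m) z in eq
  meet {z} (_ , ()) hz | inj₂ _
  ... | inj₁ a with a ≟ᶠ v
  ...   | yes a≡v = trans (sym (splitAt⁻¹-↑ˡ eq)) (cong inG a≡v)
  meet {z} gz (_ , ()) | inj₁ a | no _

  module GSide = PartialInverseSide S V G gP inG v gP-inG gP-just (gP-inG v)
  module HSide = PartialInverseSide S V H hP inH w hP-inH hP-just hP-V

  splitG : ∀ {z z′} → Adj S z z′ → GSide.EdgeOfG z z′ ⊎ (InH z × InH z′)
  splitG (inj₁ e)                     = inj₁ e
  splitG (inj₂ (a , b , pa , pb , _)) = inj₂ ((a , pa) , (b , pb))

  splitH : ∀ {z z′} → Adj S z z′ → HSide.EdgeOfG z z′ ⊎ (InG z × InG z′)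
  splitH (inj₂ e)                     = inj₁ e
  splitH (inj₁ (a , b , pa , pb , _)) = inj₂ ((a , pa) , (b , pb))

  decomposition : CutDecomposition S V G H
  decomposition = record
    { left  = GSide.side InH (λ {z} → meet {z})
                         (λ {z} {z′} → inj₁) (λ {z} {z′} → splitG {z} {z′})
    ; right = HSide.side InG (λ {z} hz gz → meet {z} gz hz)
                         (λ {z} {z′} → inj₂) (λ {z} {z′} → splitH {z} {z′})
    ; cover = λ {z} → cover {z}
    ; meet  = λ {z} → meet {z} }

lemma6p1 : ∀ {m k : ℕ} (G : Graph (suc m)) (v : Fin (suc m))
    (H : Graph (suc k)) (w : Fin (suc k)) (tG tH : ℕ) →
    IsTreeCoverNumber G tG → IsTreeCoverNumber H tH →
    IsTreeCoverNumber (vertexSum G v H w) (tG + tH ∸ 1)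
lemma6p1 G v H w tG tH (coverG , minG) (coverH , minH) =
  upperBound coverG coverH , λ K coverS → lowerBound minG minH coverS
  where open GluingAtCutVertex (VertexSumDecomposition.decomposition G v H w)
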